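{- For every $t,u\in\mathrm{PT}$: (1) $t\le t^{\mathfrak m}$; (2) if $t\le u$, then $u\le t^{\mathfrak m}$. In particular, $t^{\mathfrak m}$ is the unique maximal element of $\{u\in\mathrm{PT}: t\le u\}$.
   Context: A tree is a nonempty prefix-closed finitely branching set $A\subseteq(\mathbb N^+)^*$ with $wj\in A$, $i<j$ implying $wi\in A$. A permutation tree is a map $t:A\to\mathrm{Sym}(\mathbb N^+)$ (possibly infinite) such that a node with exactly $n$ children has label in $S_n$ (permutations of $\mathbb N^+$ fixing all $i>n$). Write $t=\langle\pi;t_1,..,t_n\rangle$; $\bar\epsilon$ is the one-node tree; $\iota$ the identity. $\mathrm{PT}$ is the set of permutation trees, an inverse monoid with product (coinductive): $t\bar\epsilon=t=\bar\epsilon t$; for $t=\langle\pi;t_1..t_n\rangle$, $u=\langle\rho;u_1..u_m\rangle$: if $n\ge m$, $tu=\langle\pi\circ\rho;u_1t_{\rho1},..,u_mt_{\rho m},t_{m+1},..,t_n\rangle$; if $m\ge n$, $tu=\langle\pi\circ\rho;u_1t_{\rho1},..,u_mt_{\rho m}\rangle$ with $t_j:=\bar\epsilon$ for $j>n$; and $\bar\epsilon^*=\bar\epsilon$, $t^*=\langle\pi^{ -1};(t_{\pi^{ -1}1})^*,..,(t_{\pi^{ -1}n})^*\rangle$. Natural order: $t\le u$ iff $tt^*u=t$. $E$ is the set of permutation trees all of whose labels are $\iota$. $t^{\mathfrak m}$ is defined coinductively: $\bar\epsilon^{\mathfrak m}=\bar\epsilon$; for $t=\langle\pi;t_1..t_n\rangle$,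 $t^{\mathfrak m}=(\langle\pi;t_1..t_{n-1}\rangle)^{\mathfrak m}$ if $t_n\in E$ and $\pi n=n$, otherwise $t^{\mathfrak m}=\langle\pi;t_1^{\mathfrak m},..,t_n^{\mathfrak m}\rangle$. -}

module Defs where

open import Data.Nat using (ℕ; zero; suc; _≤_; _<_; _⊔_; _<?_)
open import Data.Nat.Properties using (m⊔n≤o⇒m≤o; m⊔n≤o⇒n≤o)
open import Data.List using (List; []; _∷_; _++_; [_])
open import Data.Product using (_×_)
open import Relation.Nullary using (¬_; yes; no)
open import Relation.Binary.PropositionalEquality
  using (_≡_; refl; sym; trans; cong)

-- Node labels.  A node with n children carries a permutation of ℕ
-- fixing every i ≥ n (an element of S_n), together with its inverse.
-- Children are indexed 0,1,2,… (the paper uses 1,2,…).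

record Node : Set where
  field
    arity  : ℕ
    perm   : ℕ → ℕ
    perm⁻¹ : ℕ → ℕ
    inv-l  : ∀ i → perm⁻¹ (perm i) ≡ i
    inv-r  : ∀ i → perm (perm⁻¹ i) ≡ i
    fixes  : ∀ i → arity ≤ i → perm i ≡ i
open Node public

-- Permutation trees (possibly infinite), represented by their labelling
-- on addresses: address  i ∷ w  is "go to child i, then follow w".
-- The node set A of t is the set of addresses  Addr t  (below); the
-- values of t outside A are irrelevant junk, ignored by _≈_.

PT : Set
PT = List ℕ → Node

child : PT → ℕ → PT
child t i w = t (i ∷ w)

sub : PT → List ℕ → PT
sub t w v = t (w ++ v)

data Addr (t : PT) : List ℕ → Set where
  root : Addr t []
  step : ∀ {i w} → i < arity (t []) → Addr (child t i) w → Addr t (i ∷ w)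

leaf : Node
arity  leaf = 0
perm   leaf i = i
perm⁻¹ leaf i = i
inv-l  leaf i = refl
inv-r  leaf i = refl
fixes  leaf i _ = refl

ε̄ : PT
ε̄ _ = leaf

childε : PT → ℕ → PT
childε t j with j <? arity (t [])
... | yes _ = child t j
... | no  _ = ε̄

-- Product:  tu = ⟨π∘ρ; u_1 t_{ρ1}, …, u_m t_{ρm}, t_{m+1}, …, t_n⟩

nodeProd : Node → Node → Node
arity  (nodeProd a b) = arity a ⊔ arity b
perm   (nodeProd a b) i = perm a (perm b i)
perm⁻¹ (nodeProd a b) i = perm⁻¹ b (perm⁻¹ a i)
inv-l  (nodeProd a b) i = trans (cong (perm⁻¹ b) (inv-l a (perm b i))) (inv-l b i)
inv-r  (nodeProd a b) i = trans (cong (perm a) (inv-r b (perm⁻¹ a i))) (inv-r a i)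
fixes  (nodeProd a b) i le =
  trans (cong (perm a) (fixes b i (m⊔n≤o⇒n≤o (arity a) (arity b) le)))
        (fixes a i (m⊔n≤o⇒m≤o (arity a) (arity b) le))

infixl 7 _·_
_·_ : PT → PT → PT
(t · u) [] = nodeProd (t []) (u [])
(t · u) (i ∷ w) with i <? arity (u [])
... | yes _ = (child u i · childε t (perm (u []) i)) w
... | no  _ = t (i ∷ w)

-- Inverse:  t* = ⟨π⁻¹; (t_{π⁻¹1})*, …, (t_{π⁻¹n})*⟩

nodeInv : Node → Node
arity  (nodeInv a) = arity a
perm   (nodeInv a) = perm⁻¹ a
perm⁻¹ (nodeInv a) = perm a
inv-l  (nodeInv a) = inv-r a
inv-r  (nodeInv a) = inv-l a
fixes  (nodeInv a) i le = trans (cong (perm⁻¹ a) (sym (fixes a i le))) (inv-l a i)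

star : PT → PT
star t [] = nodeInv (t [])
star t (i ∷ w) = star (child t (perm⁻¹ (t []) i)) w

-- Equality of permutation trees: same node set and same labels.
-- (By induction on addresses, agreement of arities at all nodes of t
-- forces the node sets to coincide.)

infix 4 _≈_ _≤ᴾ_
_≈_ : PT → PT → Set
t ≈ u = ∀ w → Addr t w →
        (arity (t w) ≡ arity (u w)) × (∀ i → perm (t w) i ≡ perm (u w) i)

_≤ᴾ_ : PT → PT → Set
t ≤ᴾ u = (t · star t) · u ≈ t

InE : PT → Set
InE t = ∀ w → Addr t w → ∀ i → perm (t w) i ≡ i

-- The coinductive definition of t^𝔪 strips trailing children t_j with
-- t_j ∈ E and π j = j as long as possible, leaving k children, and then
-- recurses into the remaining k children.  Unfolded over all nodes
-- w of s (each of which is also a node of t), this says: at w, s has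
-- k ≤ n children (n = number of children of t at w), all children
-- j ∈ [k, n) of t at w are in E and fixed by t's label, child k-1 (if
-- k ≥ 1) is not (both in E and fixed), and s and t have the same label
-- at w.  (0-based: child j is the paper's t_{j+1}.)

record MNode (t s : PT) (w : List ℕ) : Set where
  field
    arity-≤  : arity (s w) ≤ arity (t w)
    stripped : ∀ j → arity (s w) ≤ j → j < arity (t w) →
               InE (sub t (w ++ [ j ])) × perm (t w) j ≡ j
    maximal  : ∀ j → suc j ≡ arity (s w) →
               ¬ (InE (sub t (w ++ [ j ])) × perm (t w) j ≡ j)
    label    : ∀ i → perm (s w) i ≡ perm (t w) i
open MNode public

IsM : PT → PT → Set
IsM t s = ∀ w → Addr s w → MNode t s w

-- t ≤ u holds exactly when u is a pruning of t: at every node of u, u keeps an initial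
-- segment of the children of the corresponding node of t, with the same label, and every
-- dropped child is a subtree in E fixed by that label.  Both directions go by simultaneous
-- induction on addresses over the two forms t = t t* u and t = u t* t of t ≤ u, which trade
-- places when passing to a child; dropped children are handled by t ∈ E ⇔ t = t t* ⇔ t = t* t.
-- Now t^𝔪 is the pruning of t that drops as much as possible at every node.  A pruning u
-- of t cannot drop the last child kept by t^𝔪, since that child is not droppable, so u keeps
-- every child t^𝔪 keeps, and what t^𝔪 drops beyond u is droppable in u too.
module Submission where

open import Defs
open import Data.Product using (_×_; _,_; proj₁; proj₂)
open import Data.Nat using (ℕ; zero; suc; _≤_; _<_; _⊔_; _<?_; _≤?_; z≤n)
open import Data.Nat.Properties
  using (≤-pred; ≮⇒≥; <⇒≱; ≰⇒>; <-≤-trans; ⊔-idem; m<n⇒m<n⊔o; m≤m⊔n; m≤n⊔m;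
         m≥n⇒m⊔n≡m; m≤n⇒m⊔n≡n)
open import Data.List using ([]; _∷_; _++_; [_])
open import Relation.Nullary using (¬_; yes; no; contradiction)
open import Relation.Binary.PropositionalEquality
  using (_≡_; refl; sym; trans; cong; cong₂; subst; _≗_)

infix 4 _≃ᴺ_ _≃_
record _≃ᴺ_ (a b : Node) : Set where
  constructor _,_
  field
    arity-≡ : arity a ≡ arity b
    perm-≡  : ∀ i → perm a i ≡ perm b i
open _≃ᴺ_

≃ᴺ-refl : ∀ {a} → a ≃ᴺ a
≃ᴺ-refl = refl , λ _ → refl

≃ᴺ-sym : ∀ {a b} → a ≃ᴺ b → b ≃ᴺ a
≃ᴺ-sym (e , p) = sym e , λ i → sym (p i)

≃ᴺ-trans : ∀ {a b c} → a ≃ᴺ b → b ≃ᴺ c → a ≃ᴺ c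
≃ᴺ-trans (e , p) (e′ , p′) = trans e e′ , λ i → trans (p i) (p′ i)

≃ᴺ-respʳ : ∀ {a b b′} → b ≡ b′ → a ≃ᴺ b → a ≃ᴺ b′
≃ᴺ-respʳ refl r = r

-- The relation _≈_ of Defs, with a record in place of the pair so that the nodes compared are inferable.
_≃_ : PT → PT → Set
t ≃ u = ∀ w → Addr t w → t w ≃ᴺ u w

≈⇒≃ : ∀ {t u} → t ≈ u → t ≃ u
≈⇒≃ t≈u w a = proj₁ (t≈u w a) , proj₂ (t≈u w a)

≃⇒≈ : ∀ {t u} → t ≃ u → t ≈ u
≃⇒≈ t≃u w a = arity-≡ (t≃u w a) , perm-≡ (t≃u w a)

≃-Addr : ∀ {t u w} → t ≃ u → Addr u w → Addr t w
≃-Addr t≃u root = root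
≃-Addr {t} {u} t≃u (step {i} i<m a) =
  step i<n (≃-Addr {child t i} {child u i} (λ v a′ → t≃u (i ∷ v) (step i<n a′)) a)
  where i<n = subst (i <_) (sym (arity-≡ (t≃u [] root))) i<m

≃-sym : ∀ {t u} → t ≃ u → u ≃ t
≃-sym {t} {u} t≃u w a = ≃ᴺ-sym (t≃u w (≃-Addr {t} {u} t≃u a))

≤ᴾ⇒≃ : ∀ {t u} → t ≤ᴾ u → t ≃ (t · star t) · u
≤ᴾ⇒≃ {t} {u} t≤u = ≃-sym {(t · star t) · u} {t} (≈⇒≃ t≤u)

≃⇒≤ᴾ : ∀ {t u} → t ≃ (t · star t) · u → t ≤ᴾ u
≃⇒≤ᴾ {t} {u} t≃tt*u = ≃⇒≈ (≃-sym {t} {(t · star t) · u} t≃tt*u)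

perm-<-arity : ∀ a {k} → k < arity a → perm a k < arity a
perm-<-arity a {k} k<n with perm a k <? arity a
... | yes πk<n = πk<n
... | no  πk≮n = contradiction (subst (_< arity a) k≡πk k<n) πk≮n
  where
  k≡πk : k ≡ perm a k
  k≡πk = trans (sym (inv-l a k))
               (trans (cong (perm⁻¹ a) (sym (fixes a (perm a k) (≮⇒≥ πk≮n))))
                      (inv-l a (perm a k)))

childε-inside : ∀ t {j} → j < arity (t []) → childε t j ≗ child t j
childε-inside t {j} j<n w with j <? arity (t [])
... | yes _   = refl
... | no  j≮n = contradiction j<n j≮n

childε-beyond : ∀ t {j} → arity (t []) ≤ j → childε t j ≗ ε̄
childε-beyond t {j} n≤j w with j <? arity (t [])
... | yes j<n = contradiction n≤j (<⇒≱ j<n)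
... | no  _   = refl

childε-cong : ∀ {t t′ j} → t ≗ t′ → childε t j ≗ childε t′ j
childε-cong {t} {t′} {j} t≗t′ w with j <? arity (t []) | j <? arity (t′ [])
... | yes _   | yes _   = t≗t′ (j ∷ w)
... | no  _   | no  _   = refl
... | yes j<n | no  j≮n = contradiction (subst (λ a → j < arity a) (t≗t′ []) j<n) j≮n
... | no  j≮n | yes j<n = contradiction (subst (λ a → j < arity a) (sym (t≗t′ [])) j<n) j≮n

·-cong : ∀ {t t′ u u′} → t ≗ t′ → u ≗ u′ → t · u ≗ t′ · u′
·-cong t≗t′ u≗u′ [] = cong₂ nodeProd (t≗t′ []) (u≗u′ [])
·-cong {t} {t′} {u} {u′} t≗t′ u≗u′ (i ∷ w) with i <? arity (u []) | i <? arity (u′ [])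
... | yes _   | yes _   =
  ·-cong (λ v → u≗u′ (i ∷ v))
         (λ v → trans (childε-cong t≗t′ v) (cong (λ a → childε t′ (perm a i) v) (u≗u′ [])))
         w
... | no  _   | no  _   = t≗t′ (i ∷ w)
... | yes i<m | no  i≮m = contradiction (subst (λ a → i < arity a) (u≗u′ []) i<m) i≮m
... | no  i≮m | yes i<m = contradiction (subst (λ a → i < arity a) (sym (u≗u′ [])) i<m) i≮m

·-child : ∀ t u {i} → i < arity (u []) → child (t · u) i ≗ child u i · childε t (perm (u []) i)
·-child t u {i} i<m w with i <? arity (u [])
... | yes _   = refl
... | no  i≮m = contradiction i<m i≮m

·-child-beyond : ∀ t u {i} → arity (u []) ≤ i → child (t · u) i ≗ child t i
·-child-beyond t u {i} m≤i w with i <? arity (u [])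
... | yes i<m = contradiction m≤i (<⇒≱ i<m)
... | no  _   = refl

·-ε̄ : ∀ t w → t w ≃ᴺ (t · ε̄) w
·-ε̄ t []      = sym (m≥n⇒m⊔n≡m z≤n) , λ _ → refl
·-ε̄ t (i ∷ w) = ≃ᴺ-respʳ (sym (·-child-beyond t ε̄ {i} z≤n w)) ≃ᴺ-refl

·star-child : ∀ t {i j} → j < arity (t []) → perm (t []) j ≡ i →
              child (t · star t) i ≗ star (child t j) · child t j
·star-child t {j = j} j<n refl w =
  trans (·-child t (star t) (perm-<-arity (t []) j<n) w)
        (·-cong (λ v → cong (λ k → star (child t k) v) (inv-l (t []) j))
                (λ v → trans (cong (λ k → childε t k v) (inv-l (t []) j)) (childε-inside t j<n v))
                w)

star·-child : ∀ t {k} → k < arity (t []) → child (star t · t) k ≗ child t k · star (child t k)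
star·-child t {k} k<n w =
  trans (·-child (star t) t k<n w)
        (·-cong (λ _ → refl)
                (λ v → trans (childε-inside (star t) (perm-<-arity (t []) k<n) v)
                             (cong (λ j → star (child t j) v) (inv-l (t []) k)))
                w)

InE-child : ∀ {t k} → InE t → k < arity (t []) → InE (child t k)
InE-child ine k<n w a = ine (_ ∷ w) (step k<n a)

InE⇒≃tt* : ∀ t → InE t → t ≃ t · star t
InE⇒≃t*t : ∀ t → InE t → t ≃ star t · t
InE⇒≃tt* t ine [] root = sym (⊔-idem _) , λ i → trans (ine [] root i) (sym (inv-r (t []) i))
InE⇒≃tt* t ine (k ∷ w) (step k<n a) =
  ≃ᴺ-respʳ (sym (·star-child t k<n (ine [] root k) w))
           (InE⇒≃t*t (child t k) (InE-child ine k<n) w a)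
InE⇒≃t*t t ine [] root = sym (⊔-idem _) , λ i → trans (ine [] root i) (sym (inv-l (t []) i))
InE⇒≃t*t t ine (k ∷ w) (step k<n a) =
  ≃ᴺ-respʳ (sym (star·-child t k<n w))
           (InE⇒≃tt* (child t k) (InE-child ine k<n) w a)

≃tt*⇒InE : ∀ t → t ≃ t · star t → InE t
≃t*t⇒InE : ∀ t → t ≃ star t · t → InE t
≃tt*⇒InE t h [] root i = trans (perm-≡ (h [] root) i) (inv-r (t []) i)
≃tt*⇒InE t h (k ∷ w) (step k<n a) = ≃t*t⇒InE (child t k) h′ w a
  where
  πk≡k : perm (t []) k ≡ k
  πk≡k = trans (perm-≡ (h [] root) k) (inv-r (t []) k)
  h′ : child t k ≃ star (child t k) · child t k
  h′ v a′ = ≃ᴺ-respʳ (·star-child t k<n πk≡k v) (h (k ∷ v) (step k<n a′))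
≃t*t⇒InE t h [] root i = trans (perm-≡ (h [] root) i) (inv-l (t []) i)
≃t*t⇒InE t h (k ∷ w) (step k<n a) = ≃tt*⇒InE (child t k) h′ w a
  where
  h′ : child t k ≃ child t k · star (child t k)
  h′ v a′ = ≃ᴺ-respʳ (star·-child t k<n v) (h (k ∷ v) (step k<n a′))

tt*u-child-kept : ∀ t u {i} → i < arity (u []) → i < arity (t []) → perm (u []) i ≡ perm (t []) i →
                  child ((t · star t) · u) i ≗ child u i · (star (child t i) · child t i)
tt*u-child-kept t u {i} i<m i<n ρi≡πi w =
  trans (·-child (t · star t) u i<m w)
        (·-cong (λ _ → refl)
                (λ v → trans (childε-inside (t · star t) (m<n⇒m<n⊔o (arity (t [])) ρi<n) v)
                             (·star-child t i<n (sym ρi≡πi) v))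
                w)
  where
  ρi<n : perm (u []) i < arity (t [])
  ρi<n = subst (_< arity (t [])) (sym ρi≡πi) (perm-<-arity (t []) i<n)

tt*u-child-pruned : ∀ t u {i} → arity (u []) ≤ i → i < arity (t []) → perm (t []) i ≡ i →
                    child ((t · star t) · u) i ≗ star (child t i) · child t i
tt*u-child-pruned t u m≤i i<n πi≡i w =
  trans (·-child-beyond (t · star t) u m≤i w) (·star-child t i<n πi≡i w)

ut*t-child : ∀ t u {k} → k < arity (t []) →
             child (u · (star t · t)) k ≗ (child t k · star (child t k)) · childε u k
ut*t-child t u {k} k<n w =
  trans (·-child u (star t · t) (m<n⇒m<n⊔o (arity (t [])) k<n) w)
        (·-cong (star·-child t k<n) (λ v → cong (λ j → childε u j v) (inv-l (t []) k)) w)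

ut*t-child-kept : ∀ t u {k} → k < arity (t []) → k < arity (u []) →
                  child (u · (star t · t)) k ≗ (child t k · star (child t k)) · child u k
ut*t-child-kept t u k<n k<m w =
  trans (ut*t-child t u k<n w) (·-cong (λ _ → refl) (childε-inside u k<m) w)

ut*t-child-pruned : ∀ t u {k} → k < arity (t []) → arity (u []) ≤ k →
                    child (u · (star t · t)) k ≗ (child t k · star (child t k)) · ε̄
ut*t-child-pruned t u k<n m≤k w =
  trans (ut*t-child t u k<n w) (·-cong (λ _ → refl) (childε-beyond u m≤k) w)

record NodePruning (a : Node) (ts : ℕ → PT) (b : Node) : Set where
  field
    arity-≤  : arity b ≤ arity a
    stripped : ∀ j → arity b ≤ j → j < arity a → InE (ts j) × perm a j ≡ j
    label    : ∀ i → perm b i ≡ perm a i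
open NodePruning

Pruning : PT → PT → Set
Pruning t u = ∀ w → Addr u w → NodePruning (t w) (λ j → sub t (w ++ [ j ])) (u w)

Pruning-child : ∀ {t u i} → Pruning t u → i < arity (u []) → Pruning (child t i) (child u i)
Pruning-child p i<m w a = p (_ ∷ w) (step i<m a)

Pruning⇒≃tt*u : ∀ t u → Pruning t u → t ≃ (t · star t) · u
Pruning⇒≃ut*t : ∀ t u → Pruning t u → t ≃ u · (star t · t)
Pruning⇒≃tt*u t u p [] root =
  sym (trans (cong (_⊔ arity (u [])) (⊔-idem _)) (m≥n⇒m⊔n≡m (arity-≤ r))) ,
  λ i → sym (trans (inv-r (t []) (perm (u []) i)) (label r i))
  where r = p [] root
-- Splitting on i <? arity (u []) instead would abstract the test that _·_ performs in the goal.
Pruning⇒≃tt*u t u p (i ∷ w) (step i<n a) with arity (u []) ≤? i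
... | no  m≰i =
  ≃ᴺ-respʳ (sym (tt*u-child-kept t u (≰⇒> m≰i) i<n (label (p [] root) i) w))
           (Pruning⇒≃ut*t (child t i) (child u i) (Pruning-child p (≰⇒> m≰i)) w a)
... | yes m≤i with stripped (p [] root) i m≤i i<n
...   | ine , πi≡i =
  ≃ᴺ-respʳ (sym (tt*u-child-pruned t u m≤i i<n πi≡i w)) (InE⇒≃t*t (child t i) ine w a)
Pruning⇒≃ut*t t u p [] root =
  sym (trans (cong (arity (u []) ⊔_) (⊔-idem _)) (m≤n⇒m⊔n≡n (arity-≤ r))) ,
  λ i → sym (trans (cong (perm (u [])) (inv-l (t []) i)) (label r i))
  where r = p [] root
Pruning⇒≃ut*t t u p (k ∷ w) (step k<n a) with arity (u []) ≤? k
... | no  m≰k =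
  ≃ᴺ-respʳ (sym (ut*t-child-kept t u k<n (≰⇒> m≰k) w))
           (Pruning⇒≃tt*u (child t k) (child u k) (Pruning-child p (≰⇒> m≰k)) w a)
... | yes m≤k =
  ≃ᴺ-respʳ (sym (ut*t-child-pruned t u k<n m≤k w))
           (≃ᴺ-trans (InE⇒≃tt* (child t k) ine w a) (·-ε̄ (child t k · star (child t k)) w))
  where ine = proj₁ (stripped (p [] root) k m≤k k<n)

≃tt*u⇒NodePruning[] : ∀ t u → t ≃ (t · star t) · u → NodePruning (t []) (child t) (u [])
≃tt*u⇒NodePruning[] t u h = record { arity-≤ = m≤n ; stripped = strip ; label = ρ≗π }
  where
  r = h [] root
  m≤n : arity (u []) ≤ arity (t [])
  m≤n = subst (arity (u []) ≤_) (sym (arity-≡ r)) (m≤n⊔m _ _)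
  ρ≗π : ∀ i → perm (u []) i ≡ perm (t []) i
  ρ≗π i = trans (sym (inv-r (t []) (perm (u []) i))) (sym (perm-≡ r i))
  strip : ∀ j → arity (u []) ≤ j → j < arity (t []) → InE (child t j) × perm (t []) j ≡ j
  strip j m≤j j<n = ≃t*t⇒InE (child t j) h′ , πj≡j
    where
    πj≡j = trans (sym (ρ≗π j)) (fixes (u []) j m≤j)
    h′ : child t j ≃ star (child t j) · child t j
    h′ v a = ≃ᴺ-respʳ (tt*u-child-pruned t u m≤j j<n πj≡j v) (h (j ∷ v) (step j<n a))

≃ut*t⇒NodePruning[] : ∀ t u → t ≃ u · (star t · t) → NodePruning (t []) (child t) (u [])
≃ut*t⇒NodePruning[] t u h = record { arity-≤ = m≤n ; stripped = strip ; label = ρ≗π }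
  where
  r = h [] root
  m≤n : arity (u []) ≤ arity (t [])
  m≤n = subst (arity (u []) ≤_) (sym (arity-≡ r)) (m≤m⊔n _ _)
  ρ≗π : ∀ i → perm (u []) i ≡ perm (t []) i
  ρ≗π i = trans (cong (perm (u [])) (sym (inv-l (t []) i))) (sym (perm-≡ r i))
  strip : ∀ j → arity (u []) ≤ j → j < arity (t []) → InE (child t j) × perm (t []) j ≡ j
  strip j m≤j j<n = ≃tt*⇒InE (child t j) h′ , trans (sym (ρ≗π j)) (fixes (u []) j m≤j)
    where
    h′ : child t j ≃ child t j · star (child t j)
    h′ v a = ≃ᴺ-trans (≃ᴺ-respʳ (ut*t-child-pruned t u j<n m≤j v) (h (j ∷ v) (step j<n a)))
                      (≃ᴺ-sym (·-ε̄ (child t j · star (child t j)) v))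

≃tt*u⇒Pruning : ∀ t u → t ≃ (t · star t) · u → Pruning t u
≃ut*t⇒Pruning : ∀ t u → t ≃ u · (star t · t) → Pruning t u
≃tt*u⇒Pruning t u h [] root = ≃tt*u⇒NodePruning[] t u h
≃tt*u⇒Pruning t u h (i ∷ w) (step i<m a) = ≃ut*t⇒Pruning (child t i) (child u i) h′ w a
  where
  r = ≃tt*u⇒NodePruning[] t u h
  i<n = <-≤-trans i<m (arity-≤ r)
  h′ : child t i ≃ child u i · (star (child t i) · child t i)
  h′ v a′ = ≃ᴺ-respʳ (tt*u-child-kept t u i<m i<n (label r i) v) (h (i ∷ v) (step i<n a′))
≃ut*t⇒Pruning t u h [] root = ≃ut*t⇒NodePruning[] t u h
≃ut*t⇒Pruning t u h (k ∷ w) (step k<m a) = ≃tt*u⇒Pruning (child t k) (child u k) h′ w a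
  where
  k<n = <-≤-trans k<m (arity-≤ (≃ut*t⇒NodePruning[] t u h))
  h′ : child t k ≃ (child t k · star (child t k)) · child u k
  h′ v a′ = ≃ᴺ-respʳ (ut*t-child-kept t u k<n k<m v) (h (k ∷ v) (step k<n a′))

Pruning⇒≤ᴾ : ∀ {t u} → Pruning t u → t ≤ᴾ u
Pruning⇒≤ᴾ {t} {u} p = ≃⇒≤ᴾ (Pruning⇒≃tt*u t u p)

≤ᴾ⇒Pruning : ∀ {t u} → t ≤ᴾ u → Pruning t u
≤ᴾ⇒Pruning {t} {u} t≤u = ≃tt*u⇒Pruning t u (≤ᴾ⇒≃ t≤u)

Pruning-Addr : ∀ {t u w} → Pruning t u → Addr u w → Addr t w
Pruning-Addr p root = root
Pruning-Addr p (step i<m a) =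
  step (<-≤-trans i<m (arity-≤ (p [] root))) (Pruning-Addr (Pruning-child p i<m) a)

Pruning-sub : ∀ {t u} w → Pruning t u → Addr u w → Pruning (sub t w) (sub u w)
Pruning-sub []      p root         = p
Pruning-sub (i ∷ w) p (step i<m a) = Pruning-sub w (Pruning-child p i<m) a

Pruning-InE : ∀ {t u} → Pruning t u → InE t → InE u
Pruning-InE p ine w a i = trans (label (p w a) i) (ine w (Pruning-Addr p a) i)

Addr-snoc : ∀ {t w j} → Addr t w → j < arity (t w) → Addr t (w ++ [ j ])
Addr-snoc root         j<n = step j<n root
Addr-snoc (step i<n a) j<n = step i<n (Addr-snoc a j<n)

IsM⇒Pruning : ∀ {t s} → IsM t s → Pruning t s
IsM⇒Pruning m w a = record
  { arity-≤ = arity-≤ (m w a) ; stripped = stripped (m w a) ; label = label (m w a) }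

IsM-child : ∀ {t s i} → IsM t s → i < arity (s []) → IsM (child t i) (child s i)
IsM-child m i<k w a = record
  { arity-≤ = arity-≤ n ; stripped = stripped n ; maximal = maximal n ; label = label n }
  where n = m (_ ∷ w) (step i<k a)

≤-start-of-suffix : ∀ (Q : ℕ → Set) {m n} k → k ≤ n → (∀ j → m ≤ j → j < n → Q j) →
                    (∀ j → suc j ≡ k → ¬ Q j) → k ≤ m
≤-start-of-suffix Q zero    _   _        _   = z≤n
≤-start-of-suffix Q {m} (suc k) k<n Q-suffix ¬Qk with suc k ≤? m
... | yes k<m = k<m
... | no  k≮m = contradiction (Q-suffix k (≤-pred (≰⇒> k≮m)) k<n) (¬Qk k refl)

IsM-arity-≤ : ∀ {t s w b} → MNode t s w → NodePruning (t w) (λ j → sub t (w ++ [ j ])) b →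
              arity (s w) ≤ arity b
IsM-arity-≤ {t} {w = w} n p =
  ≤-start-of-suffix (λ j → InE (sub t (w ++ [ j ])) × perm (t w) j ≡ j)
                    _ (arity-≤ n) (stripped p) (maximal n)

IsM-Addr : ∀ {t s u w} → IsM t s → Pruning t u → Addr s w → Addr u w
IsM-Addr m p root = root
IsM-Addr m p (step i<k a) =
  step i<m (IsM-Addr (IsM-child m i<k) (Pruning-child p i<m) a)
  where i<m = <-≤-trans i<k (IsM-arity-≤ (m [] root) (p [] root))

IsM⇒Pruning-of-Pruning : ∀ {t s u} → IsM t s → Pruning t u → Pruning u s
IsM⇒Pruning-of-Pruning {t} {s} {u} m p w a = record
  { arity-≤ = IsM-arity-≤ n q ; stripped = strip ; label = λ i → trans (label n i) (sym (label q i)) }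
  where
  n  = m w a
  aᵤ = IsM-Addr m p a
  q  = p w aᵤ
  strip : ∀ j → arity (s w) ≤ j → j < arity (u w) → InE (sub u (w ++ [ j ])) × perm (u w) j ≡ j
  strip j k≤j j<m with stripped n j k≤j (<-≤-trans j<m (arity-≤ q))
  ... | ine , πj≡j =
    Pruning-InE (Pruning-sub (w ++ [ j ]) p (Addr-snoc aᵤ j<m)) ine , trans (label q j) πj≡j

proposition3p9 : (t s : PT) → IsM t s → (t ≤ᴾ s) × ((u : PT) → t ≤ᴾ u → u ≤ᴾ s)
proposition3p9 t s m =
  Pruning⇒≤ᴾ (IsM⇒Pruning m) ,
  λ u t≤u → Pruning⇒≤ᴾ (IsM⇒Pruning-of-Pruning m (≤ᴾ⇒Pruning t≤u))
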